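{- Let $T$ be an out-star with centre $c$ and leaves $\ell_1,\dots,\ell_n$ (arcs $c\to\ell_i$), carrying only green pebbles: $g_0\ge0$ on $c$ and $g_i\ge 0$ on $\ell_i$. Then the game value of this \textsc{blocking pebbles} position is the nimber $*\big(g_1\oplus g_2\oplus\cdots\oplus g_n\big)$, where $\oplus$ is the nim sum.
   Context: \textsc{Blocking pebbles} with green pebbles only is an impartial game on a finite directed acyclic graph with a number of (green) pebbles on each vertex. A move by either player: choose a vertex $v$ and either (1) move a positive number of pebbles from $v$ to a single in-neighbour $u$ of $v$ (arc $u\to v$) at no cost, or (2) remove two pebbles from $v$ and place one pebble on an out-neighbour $w$ of $v$ (arc $v\to w$). Normal play. The nim sum $\oplus$ is binary addition without carry; $*n$ is the nimber $n$. -}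

module Defs where

open import Data.Nat using (ℕ; zero; suc; _+_; _*_; _∸_; _≤_; _<_)
open import Data.Nat.DivMod using (_/_; _%_)
open import Data.Fin using (Fin; zero; suc)
open import Data.Vec using (Vec; lookup; updateAt; foldr; tail)
open import Data.Product using (Σ; ∃; _×_; _,_)
open import Relation.Binary.PropositionalEquality using (_≡_; _≢_)

-- Nim sum (binary addition without carry) on ℕ.
-- nimSumFuel f a b processes f bits; fuel a + b always suffices since
-- the bit length of x is at most x.

nimSumFuel : ℕ → ℕ → ℕ → ℕ
nimSumFuel zero    a b = 0
nimSumFuel (suc f) a b =
  ((a % 2 + b % 2) % 2) + 2 * nimSumFuel f (a / 2) (b / 2)

_⊕_ : ℕ → ℕ → ℕ
a ⊕ b = nimSumFuel (a + b) a b

infixl 6 _⊕_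

-- Blocking pebbles with green pebbles only, on a digraph with vertex
-- set Fin V and arc relation Arc (Arc u v means an arc u → v).
-- A position assigns a number of green pebbles to each vertex.

Position : ℕ → Set
Position V = Vec ℕ V

data Move {V : ℕ} (Arc : Fin V → Fin V → Set) (p : Position V)
          : Position V → Set where
  pull : (u v : Fin V) → Arc u v → (m : ℕ) → 1 ≤ m → m ≤ lookup p v →
         Move Arc p (updateAt (updateAt p v (λ x → x ∸ m)) u (λ x → x + m))
  push : (v w : Fin V) → Arc v w → 2 ≤ lookup p v →
         Move Arc p (updateAt (updateAt p v (λ x → x ∸ 2)) w suc)

-- Sprague–Grundy value (the game value of an impartial game is the
-- nimber * k where k is its Grundy value), as an inductive relation:
-- Grundy Arc p k  iff  k = mex { Grundy value of q | p → q a move }.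

data Grundy {V : ℕ} (Arc : Fin V → Fin V → Set) (p : Position V) : ℕ → Set where
  mex : (k : ℕ) →
        (∀ q → Move Arc p q → Σ ℕ λ j → Grundy Arc q j × j ≢ k) →
        (∀ j → j < k → Σ (Position V) λ q → Move Arc p q × Grundy Arc q j) →
        Grundy Arc p k

data StarArc {n : ℕ} : Fin (suc n) → Fin (suc n) → Set where
  c→ℓ : (i : Fin n) → StarArc zero (suc i)

nimSumVec : {n : ℕ} → Vec ℕ n → ℕ
nimSumVec = foldr _ _⊕_ 0

-- The leaves behave like Nim heaps and the centre merely absorbs pebbles: a pull
-- lowers one heap arbitrarily and a push raises one heap by one, so, ⊕ being
-- cancellative, every move changes the nim sum of the leaves, while the usual
-- Nim strategy reaches every smaller value by a pull.  Every move strictly lowers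
-- the potential 2·g₀ + 3·(g₁ + ⋯ + gₙ), so induction on it yields the mex
-- characterisation of the Grundy value.

module Submission where

open import Defs
open import Data.Nat using (ℕ; zero; suc; _+_; _*_; _∸_; _≤_; _<_; z≤n; s≤s)
open import Data.Nat.Properties
open import Data.Nat.DivMod
open import Data.Nat.Induction using (<-rec; <-wellFounded)
open import Data.Nat.Solver using (module +-*-Solver)
open import Data.Fin using (zero; suc)
open import Data.Vec using (Vec; []; _∷_; lookup; updateAt; tail; sum)
open import Data.Product using (Σ; ∃; _×_; _,_)
import Data.Product as Product
open import Data.Sum using (_⊎_; inj₁; inj₂)
import Data.Sum as Sum
open import Function using (id; _on_; _⇔_; mk⇔; Equivalence)
open import Induction.WellFounded using (Acc; acc)
open import Relation.Binary.Construct.On using (wellFounded)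
open import Relation.Binary.PropositionalEquality
open import Relation.Nullary using (contradiction)

open ≡-Reasoning
open Equivalence using (to; from)

nimSumFuel-0-0 : ∀ f → nimSumFuel f 0 0 ≡ 0
nimSumFuel-0-0 zero    = refl
nimSumFuel-0-0 (suc f) = cong (2 *_) (nimSumFuel-0-0 f)

halves-≤ : ∀ a b f → a + b ≤ suc f → a / 2 + b / 2 ≤ f
halves-≤ zero    zero    f _ = z≤n
halves-≤ zero    (suc b) f h = <⇒≤pred (<-≤-trans (m/n<m (suc b) 2 (s≤s (s≤s z≤n))) h)
halves-≤ (suc a) b       f h =
  <⇒≤pred (<-≤-trans (+-mono-<-≤ (m/n<m (suc a) 2 (s≤s (s≤s z≤n))) (m/n≤m b 2)) h)

nimSumFuel-stable : ∀ f g a b → a + b ≤ f → a + b ≤ g → nimSumFuel f a b ≡ nimSumFuel g a b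
nimSumFuel-stable zero    zero    a    b    _  _  = refl
nimSumFuel-stable zero    (suc g) zero zero _  _  = sym (nimSumFuel-0-0 (suc g))
nimSumFuel-stable (suc f) zero    zero zero _  _  = nimSumFuel-0-0 (suc f)
nimSumFuel-stable (suc f) (suc g) a    b    hf hg =
  cong (λ t → (a % 2 + b % 2) % 2 + 2 * t)
       (nimSumFuel-stable f g (a / 2) (b / 2) (halves-≤ a b f hf) (halves-≤ a b g hg))

⊕-unfold : ∀ a b → a ⊕ b ≡ (a % 2 + b % 2) % 2 + 2 * (a / 2 ⊕ b / 2)
⊕-unfold a b = begin
  nimSumFuel (a + b) a b
    ≡⟨ nimSumFuel-stable (a + b) (suc (a + b)) a b ≤-refl (n≤1+n _) ⟩
  (a % 2 + b % 2) % 2 + 2 * nimSumFuel (a + b) (a / 2) (b / 2)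
    ≡⟨ cong (λ t → (a % 2 + b % 2) % 2 + 2 * t)
            (nimSumFuel-stable (a + b) (a / 2 + b / 2) (a / 2) (b / 2)
                               (halves-≤ a b (a + b) (n≤1+n _)) ≤-refl) ⟩
  (a % 2 + b % 2) % 2 + 2 * (a / 2 ⊕ b / 2) ∎

m%2≡0⊎m%2≡1 : ∀ m → m % 2 ≡ 0 ⊎ m % 2 ≡ 1
m%2≡0⊎m%2≡1 m with m % 2 | m%n<n m 2
... | 0 | _ = inj₁ refl
... | 1 | _ = inj₂ refl
... | suc (suc _) | s≤s (s≤s ())

≡-by-bits : ∀ {x y} → x % 2 ≡ y % 2 → x / 2 ≡ y / 2 → x ≡ y
≡-by-bits {x} {y} bit half = begin
  x                   ≡⟨ m≡m%n+[m/n]*n x 2 ⟩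
  x % 2 + x / 2 * 2   ≡⟨ cong₂ (λ r q → r + q * 2) bit half ⟩
  y % 2 + y / 2 * 2   ≡⟨ m≡m%n+[m/n]*n y 2 ⟨
  y                   ∎

[m%2+2n]%2≡m%2 : ∀ m n → (m % 2 + 2 * n) % 2 ≡ m % 2
[m%2+2n]%2≡m%2 m n = begin
  (m % 2 + 2 * n) % 2  ≡⟨ cong (λ t → (m % 2 + t) % 2) (*-comm 2 n) ⟩
  (m % 2 + n * 2) % 2  ≡⟨ [m+kn]%n≡m%n (m % 2) n 2 ⟩
  m % 2 % 2            ≡⟨ m%n%n≡m%n m 2 ⟩
  m % 2                ∎

[m%2+2n]/2≡n : ∀ m n → (m % 2 + 2 * n) / 2 ≡ n
[m%2+2n]/2≡n m n = begin
  (m % 2 + 2 * n) / 2      ≡⟨ cong (λ t → (m % 2 + t) / 2) (*-comm 2 n) ⟩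
  (m % 2 + n * 2) / 2      ≡⟨ +-distrib-/ (m % 2) (n * 2) digits<2 ⟩
  m % 2 / 2 + n * 2 / 2    ≡⟨ cong₂ _+_ (m<n⇒m/n≡0 (m%n<n m 2)) (m*n/n≡m n 2) ⟩
  n                        ∎
  where
  digits<2 : m % 2 % 2 + n * 2 % 2 < 2
  digits<2 = subst₂ (λ r s → r + s < 2) (sym (m%n%n≡m%n m 2)) (sym (m*n%n≡0 n 2))
                    (subst (_< 2) (sym (+-identityʳ (m % 2))) (m%n<n m 2))

%2-congˡ-+ : ∀ {x y} z → x % 2 ≡ y % 2 → (x + z) % 2 ≡ (y + z) % 2
%2-congˡ-+ {x} {y} z eq = begin
  (x + z) % 2              ≡⟨ %-distribˡ-+ x z 2 ⟩
  (x % 2 + z % 2) % 2      ≡⟨ cong (λ r → (r + z % 2) % 2) eq ⟩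
  (y % 2 + z % 2) % 2      ≡⟨ %-distribˡ-+ y z 2 ⟨
  (y + z) % 2              ∎

%2-congʳ-+ : ∀ x {y z} → y % 2 ≡ z % 2 → (x + y) % 2 ≡ (x + z) % 2
%2-congʳ-+ x {y} {z} eq =
  trans (cong (_% 2) (+-comm x y)) (trans (%2-congˡ-+ {y} {z} x eq) (cong (_% 2) (+-comm z x)))

⊕-%2 : ∀ a b → (a ⊕ b) % 2 ≡ (a + b) % 2
⊕-%2 a b = begin
  (a ⊕ b) % 2                                   ≡⟨ cong (_% 2) (⊕-unfold a b) ⟩
  ((a % 2 + b % 2) % 2 + 2 * (a / 2 ⊕ b / 2)) % 2 ≡⟨ [m%2+2n]%2≡m%2 (a % 2 + b % 2) (a / 2 ⊕ b / 2) ⟩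
  (a % 2 + b % 2) % 2                           ≡⟨ %-distribˡ-+ a b 2 ⟨
  (a + b) % 2                                   ∎

⊕-/2 : ∀ a b → (a ⊕ b) / 2 ≡ a / 2 ⊕ b / 2
⊕-/2 a b = trans (cong (_/ 2) (⊕-unfold a b)) ([m%2+2n]/2≡n (a % 2 + b % 2) (a / 2 ⊕ b / 2))

halving-induction : (P : ℕ → Set) → P 0 → (∀ x → 0 < x → P (x / 2) → P x) → ∀ x → P x
halving-induction P base step = <-rec P rec
  where
  rec : ∀ x → (∀ {y} → y < x → P y) → P x
  rec zero    _  = base
  rec (suc x) ih = step (suc x) (s≤s z≤n) (ih (m/n<m (suc x) 2 (s≤s (s≤s z≤n))))

⊕-comm : ∀ a b → a ⊕ b ≡ b ⊕ a
⊕-comm a b = trans (cong (λ f → nimSumFuel f a b) (+-comm a b)) (fuel-comm (b + a) a b)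
  where
  fuel-comm : ∀ f a b → nimSumFuel f a b ≡ nimSumFuel f b a
  fuel-comm zero    a b = refl
  fuel-comm (suc f) a b =
    cong₂ (λ r t → r % 2 + 2 * t) (+-comm (a % 2) (b % 2)) (fuel-comm f (a / 2) (b / 2))

⊕-identityˡ : ∀ x → 0 ⊕ x ≡ x
⊕-identityˡ = halving-induction (λ x → 0 ⊕ x ≡ x) refl
  (λ x _ ih → ≡-by-bits (⊕-%2 0 x) (trans (⊕-/2 0 x) ih))

⊕-identityʳ : ∀ x → x ⊕ 0 ≡ x
⊕-identityʳ x = trans (⊕-comm x 0) (⊕-identityˡ x)

⊕-self : ∀ x → x ⊕ x ≡ 0
⊕-self = halving-induction (λ x → x ⊕ x ≡ 0) refl
  (λ x _ ih → ≡-by-bits (trans (⊕-%2 x x) (x+x%2≡0 x)) (trans (⊕-/2 x x) ih))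
  where
  x+x%2≡0 : ∀ x → (x + x) % 2 ≡ 0
  x+x%2≡0 x = trans (cong (λ t → (x + t) % 2) (sym (+-identityʳ x)))
                    (trans (cong (_% 2) (*-comm 2 x)) (m*n%n≡0 x 2))

⊕-assoc : ∀ a b c → a ⊕ b ⊕ c ≡ a ⊕ (b ⊕ c)
⊕-assoc = halving-induction (λ a → ∀ b c → a ⊕ b ⊕ c ≡ a ⊕ (b ⊕ c))
  (λ b c → trans (cong (_⊕ c) (⊕-identityˡ b)) (sym (⊕-identityˡ (b ⊕ c))))
  (λ a _ ih b c → ≡-by-bits (bits a b c) (halves a b c (ih (b / 2) (c / 2))))
  where
  bits : ∀ a b c → (a ⊕ b ⊕ c) % 2 ≡ (a ⊕ (b ⊕ c)) % 2
  bits a b c = begin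
    (a ⊕ b ⊕ c) % 2     ≡⟨ ⊕-%2 (a ⊕ b) c ⟩
    (a ⊕ b + c) % 2     ≡⟨ %2-congˡ-+ {a ⊕ b} {a + b} c (⊕-%2 a b) ⟩
    (a + b + c) % 2     ≡⟨ cong (_% 2) (+-assoc a b c) ⟩
    (a + (b + c)) % 2   ≡⟨ %2-congʳ-+ a {b ⊕ c} {b + c} (⊕-%2 b c) ⟨
    (a + (b ⊕ c)) % 2   ≡⟨ ⊕-%2 a (b ⊕ c) ⟨
    (a ⊕ (b ⊕ c)) % 2   ∎
  halves : ∀ a b c → a / 2 ⊕ b / 2 ⊕ c / 2 ≡ a / 2 ⊕ (b / 2 ⊕ c / 2) →
           (a ⊕ b ⊕ c) / 2 ≡ (a ⊕ (b ⊕ c)) / 2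
  halves a b c ih = begin
    (a ⊕ b ⊕ c) / 2             ≡⟨ ⊕-/2 (a ⊕ b) c ⟩
    (a ⊕ b) / 2 ⊕ c / 2         ≡⟨ cong (_⊕ c / 2) (⊕-/2 a b) ⟩
    a / 2 ⊕ b / 2 ⊕ c / 2       ≡⟨ ih ⟩
    a / 2 ⊕ (b / 2 ⊕ c / 2)     ≡⟨ cong (a / 2 ⊕_) (⊕-/2 b c) ⟨
    a / 2 ⊕ (b ⊕ c) / 2         ≡⟨ ⊕-/2 a (b ⊕ c) ⟨
    (a ⊕ (b ⊕ c)) / 2           ∎

x⊕[x⊕y]≡y : ∀ x y → x ⊕ (x ⊕ y) ≡ y
x⊕[x⊕y]≡y x y = begin
  x ⊕ (x ⊕ y)   ≡⟨ ⊕-assoc x x y ⟨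
  x ⊕ x ⊕ y     ≡⟨ cong (_⊕ y) (⊕-self x) ⟩
  0 ⊕ y         ≡⟨ ⊕-identityˡ y ⟩
  y             ∎

x⊕y⊕y≡x : ∀ x y → x ⊕ y ⊕ y ≡ x
x⊕y⊕y≡x x y = trans (⊕-assoc x y y) (trans (cong (x ⊕_) (⊕-self y)) (⊕-identityʳ x))

⊕-cancelˡ : ∀ x {a b} → x ⊕ a ≡ x ⊕ b → a ≡ b
⊕-cancelˡ x {a} {b} eq = trans (sym (x⊕[x⊕y]≡y x a)) (trans (cong (x ⊕_) eq) (x⊕[x⊕y]≡y x b))

/2≡⇒<⇔%2< : ∀ {x y} → x / 2 ≡ y / 2 → x < y ⇔ x % 2 < y % 2
/2≡⇒<⇔%2< {x} {y} eq = mk⇔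
  (λ x<y → +-cancelʳ-< (y / 2 * 2) (x % 2) (y % 2) (subst₂ _<_ x-digits y-digits x<y))
  (λ lt → subst₂ _<_ (sym x-digits) (sym y-digits) (+-monoˡ-< (y / 2 * 2) lt))
  where
  x-digits : x ≡ x % 2 + y / 2 * 2
  x-digits = trans (m≡m%n+[m/n]*n x 2) (cong (λ h → x % 2 + h * 2) eq)
  y-digits : y ≡ y % 2 + y / 2 * 2
  y-digits = m≡m%n+[m/n]*n y 2

/2≢⇒<⇔/2< : ∀ {x y} → x / 2 ≢ y / 2 → x < y ⇔ x / 2 < y / 2
/2≢⇒<⇔/2< neq = mk⇔
  (λ x<y → ≤∧≢⇒< (/-monoˡ-≤ 2 (<⇒≤ x<y)) neq)
  (λ lt → ≰⇒> (λ y≤x → <⇒≱ lt (/-monoˡ-≤ 2 y≤x)))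

infix 4 _lowers_

-- Holds exactly when x has a 1 in the leading binary digit of d.
_lowers_ : ℕ → ℕ → Set
d lowers x = x ⊕ d < x

1-lowers⇔%2≡1 : ∀ x → 1 lowers x ⇔ x % 2 ≡ 1
1-lowers⇔%2≡1 x = mk⇔
  (λ lt → odd (x % 2) (m%n<n x 2) (subst (_< x % 2) last-digit (to same-halves lt)))
  (λ x-odd → from same-halves (subst (_< x % 2) (sym last-digit)
                                 (subst (λ r → (r + 1) % 2 < r) (sym x-odd) (s≤s z≤n))))
  where
  same-halves : x ⊕ 1 < x ⇔ (x ⊕ 1) % 2 < x % 2
  same-halves = /2≡⇒<⇔%2< (trans (⊕-/2 x 1) (⊕-identityʳ (x / 2)))
  last-digit : (x ⊕ 1) % 2 ≡ (x % 2 + 1) % 2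
  last-digit = trans (⊕-%2 x 1) (%-distribˡ-+ x 1 2)
  odd : ∀ r → r < 2 → (r + 1) % 2 < r → r ≡ 1
  odd 1 _ _ = refl
  odd (suc (suc _)) (s≤s (s≤s ())) _

⊕-%2≡1 : ∀ a b → (a ⊕ b) % 2 ≡ 1 → a % 2 ≡ 1 ⊎ b % 2 ≡ 1
⊕-%2≡1 a b odd with m%2≡0⊎m%2≡1 a
... | inj₂ a-odd  = inj₁ a-odd
... | inj₁ a-even = inj₂ (begin
  b % 2                 ≡⟨ m%n%n≡m%n b 2 ⟨
  b % 2 % 2             ≡⟨ cong (λ r → (r + b % 2) % 2) a-even ⟨
  (a % 2 + b % 2) % 2   ≡⟨ %-distribˡ-+ a b 2 ⟨
  (a + b) % 2           ≡⟨ ⊕-%2 a b ⟨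
  (a ⊕ b) % 2           ≡⟨ odd ⟩
  1                     ∎)

lowers⇔halves-lowers : ∀ {d} x → 0 < d / 2 → d lowers x ⇔ (d / 2) lowers (x / 2)
lowers⇔halves-lowers {d} x 0<d/2 =
  subst (λ t → x ⊕ d < x ⇔ t < x / 2) (⊕-/2 x d) (/2≢⇒<⇔/2< halves-differ)
  where
  halves-differ : (x ⊕ d) / 2 ≢ x / 2
  halves-differ eq = <⇒≢ 0<d/2 (sym (⊕-cancelˡ (x / 2)
    (trans (sym (⊕-/2 x d)) (trans eq (sym (⊕-identityʳ (x / 2)))))))

-- Induction on d: its low digit decides when d < 2, otherwise pass to halves.
lowers-⊕ : ∀ d a b → d lowers (a ⊕ b) → d lowers a ⊎ d lowers b
lowers-⊕ = <-rec _ rec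
  where
  rec : ∀ d → (∀ {e} → e < d → ∀ a b → e lowers (a ⊕ b) → e lowers a ⊎ e lowers b) →
        ∀ a b → d lowers (a ⊕ b) → d lowers a ⊎ d lowers b
  rec zero _ a b lt = contradiction (subst (_< a ⊕ b) (⊕-identityʳ (a ⊕ b)) lt) (<-irrefl refl)
  rec 1    _ a b lt = Sum.map (from (1-lowers⇔%2≡1 a)) (from (1-lowers⇔%2≡1 b))
                              (⊕-%2≡1 a b (to (1-lowers⇔%2≡1 (a ⊕ b)) lt))
  rec d@(suc (suc _)) ih a b lt =
    Sum.map (from (halve a)) (from (halve b))
            (ih (m/n<m d 2 (s≤s (s≤s z≤n))) (a / 2) (b / 2)
                (subst (d / 2 lowers_) (⊕-/2 a b) (to (halve (a ⊕ b)) lt)))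
    where
    halve : ∀ x → d lowers x ⇔ (d / 2) lowers (x / 2)
    halve x = lowers⇔halves-lowers x (/-monoˡ-≤ {2} {d} 2 (s≤s (s≤s z≤n)))

<⇒⊕-lowers : ∀ {j x} → j < x → (j ⊕ x) lowers x
<⇒⊕-lowers {j} {x} j<x = subst (_< x) (sym (trans (⊕-comm x (j ⊕ x)) (x⊕y⊕y≡x j x))) j<x

lowers-nimSumVec : ∀ {n} d (gs : Vec ℕ n) → d lowers nimSumVec gs →
                   ∃ λ i → d lowers lookup gs i
lowers-nimSumVec d []       ()
lowers-nimSumVec d (g ∷ gs) lt with lowers-⊕ d g (nimSumVec gs) lt
... | inj₁ lowers-g  = zero , lowers-g
... | inj₂ lowers-gs = Product.map suc id (lowers-nimSumVec d gs lowers-gs)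

nimSumVec-updateAt : ∀ {n} (gs : Vec ℕ n) i (f : ℕ → ℕ) →
  nimSumVec (updateAt gs i f) ≡ nimSumVec gs ⊕ lookup gs i ⊕ f (lookup gs i)
nimSumVec-updateAt (g ∷ gs) zero f = begin
  f g ⊕ nimSumVec gs              ≡⟨ ⊕-comm (f g) _ ⟩
  nimSumVec gs ⊕ f g              ≡⟨ cong (_⊕ f g) (x⊕y⊕y≡x (nimSumVec gs) g) ⟨
  nimSumVec gs ⊕ g ⊕ g ⊕ f g      ≡⟨ cong (λ t → t ⊕ g ⊕ f g) (⊕-comm (nimSumVec gs) g) ⟩
  g ⊕ nimSumVec gs ⊕ g ⊕ f g      ∎
nimSumVec-updateAt (g ∷ gs) (suc i) f = begin
  g ⊕ nimSumVec (updateAt gs i f)   ≡⟨ cong (g ⊕_) (nimSumVec-updateAt gs i f) ⟩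
  g ⊕ (X ⊕ a ⊕ f a)                 ≡⟨ ⊕-assoc g (X ⊕ a) (f a) ⟨
  g ⊕ (X ⊕ a) ⊕ f a                 ≡⟨ cong (_⊕ f a) (⊕-assoc g X a) ⟨
  g ⊕ X ⊕ a ⊕ f a                   ∎
  where
  X = nimSumVec gs
  a = lookup gs i

nimSumVec-updateAt-≢ : ∀ {n} (gs : Vec ℕ n) i (f : ℕ → ℕ) → f (lookup gs i) ≢ lookup gs i →
                       nimSumVec (updateAt gs i f) ≢ nimSumVec gs
nimSumVec-updateAt-≢ gs i f changed eq = changed (⊕-cancelˡ (nimSumVec gs ⊕ lookup gs i) (begin
  nimSumVec gs ⊕ lookup gs i ⊕ f (lookup gs i)  ≡⟨ nimSumVec-updateAt gs i f ⟨
  nimSumVec (updateAt gs i f)                   ≡⟨ eq ⟩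
  nimSumVec gs                                  ≡⟨ x⊕y⊕y≡x (nimSumVec gs) (lookup gs i) ⟨
  nimSumVec gs ⊕ lookup gs i ⊕ lookup gs i      ∎))

potential : ∀ {n} → Position (suc n) → ℕ
potential (g₀ ∷ gs) = 2 * g₀ + 3 * sum gs

sum-updateAt-∸ : ∀ {n} (gs : Vec ℕ n) i m → m ≤ lookup gs i →
                 sum (updateAt gs i (λ x → x ∸ m)) + m ≡ sum gs
sum-updateAt-∸ (g ∷ gs) zero m m≤g = begin
  g ∸ m + sum gs + m     ≡⟨ +-assoc (g ∸ m) (sum gs) m ⟩
  g ∸ m + (sum gs + m)   ≡⟨ cong (g ∸ m +_) (+-comm (sum gs) m) ⟩
  g ∸ m + (m + sum gs)   ≡⟨ +-assoc (g ∸ m) m (sum gs) ⟨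
  g ∸ m + m + sum gs     ≡⟨ cong (_+ sum gs) (m∸n+n≡m m≤g) ⟩
  g + sum gs             ∎
sum-updateAt-∸ (g ∷ gs) (suc i) m m≤g =
  trans (+-assoc g _ m) (cong (g +_) (sum-updateAt-∸ gs i m m≤g))

sum-updateAt-suc : ∀ {n} (gs : Vec ℕ n) i → sum (updateAt gs i suc) ≡ suc (sum gs)
sum-updateAt-suc (g ∷ gs) zero    = refl
sum-updateAt-suc (g ∷ gs) (suc i) = trans (cong (g +_) (sum-updateAt-suc gs i)) (+-suc g (sum gs))

-- A pull of m pebbles lowers the potential by m, a push by 4 - 3 = 1.
potential-decreasing : ∀ {n} {p q : Position (suc n)} → Move StarArc p q → potential q < potential p
potential-decreasing {p = g₀ ∷ gs} {q} (pull _ _ (c→ℓ i) m 1≤m m≤g) =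
  subst (potential q <_) balance (m<m+n (potential q) 1≤m)
  where
  open +-*-Solver
  S′ = sum (updateAt gs i (λ x → x ∸ m))
  balance : 2 * (g₀ + m) + 3 * S′ + m ≡ 2 * g₀ + 3 * sum gs
  balance = begin
    2 * (g₀ + m) + 3 * S′ + m   ≡⟨ solve 3 (λ g s m → con 2 :* (g :+ m) :+ con 3 :* s :+ m
                                                   := con 2 :* g :+ con 3 :* (s :+ m)) refl g₀ S′ m ⟩
    2 * g₀ + 3 * (S′ + m)       ≡⟨ cong (λ t → 2 * g₀ + 3 * t) (sum-updateAt-∸ gs i m m≤g) ⟩
    2 * g₀ + 3 * sum gs         ∎
potential-decreasing {p = g₀ ∷ gs} {q} (push _ _ (c→ℓ i) 2≤g₀) =
  subst (potential q <_) balance (m<m+n (potential q) (s≤s z≤n))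
  where
  open +-*-Solver
  balance : 2 * (g₀ ∸ 2) + 3 * sum (updateAt gs i suc) + 1 ≡ 2 * g₀ + 3 * sum gs
  balance = begin
    2 * (g₀ ∸ 2) + 3 * sum (updateAt gs i suc) + 1
      ≡⟨ cong (λ t → 2 * (g₀ ∸ 2) + 3 * t + 1) (sum-updateAt-suc gs i) ⟩
    2 * (g₀ ∸ 2) + 3 * suc (sum gs) + 1
      ≡⟨ solve 2 (λ d s → con 2 :* d :+ con 3 :* (con 1 :+ s) :+ con 1
                          := con 2 :* (d :+ con 2) :+ con 3 :* s) refl (g₀ ∸ 2) (sum gs) ⟩
    2 * (g₀ ∸ 2 + 2) + 3 * sum gs
      ≡⟨ cong (λ t → 2 * t + 3 * sum gs) (m∸n+n≡m 2≤g₀) ⟩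
    2 * g₀ + 3 * sum gs   ∎

move-changes-nimSum : ∀ {n} {p q : Position (suc n)} → Move StarArc p q →
                      nimSumVec (tail q) ≢ nimSumVec (tail p)
move-changes-nimSum {p = g₀ ∷ gs} (pull _ _ (c→ℓ i) m 1≤m m≤g) =
  nimSumVec-updateAt-≢ gs i (λ x → x ∸ m) (<⇒≢ (∸-monoʳ-< 1≤m m≤g))
move-changes-nimSum {p = g₀ ∷ gs} (push _ _ (c→ℓ i) _) =
  nimSumVec-updateAt-≢ gs i suc 1+n≢n

-- The classical winning move of Nim, played as a pull: with d = j ⊕ X, some leaf g is lowered by d.
pull-to-nimSum : ∀ {n} (p : Position (suc n)) {j} → j < nimSumVec (tail p) →
                 Σ (Position (suc n)) λ q → Move StarArc p q × nimSumVec (tail q) ≡ j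
pull-to-nimSum (g₀ ∷ gs) {j} j<X with lowers-nimSumVec (j ⊕ nimSumVec gs) gs (<⇒⊕-lowers j<X)
... | i , v<g = _ , pull zero (suc i) (c→ℓ i) (g ∸ v) (m<n⇒0<n∸m v<g) (m∸n≤m g v) , reaches-j
  where
  X = nimSumVec gs
  d = j ⊕ X
  g = lookup gs i
  v = g ⊕ d
  reaches-j : nimSumVec (updateAt gs i (λ x → x ∸ (g ∸ v))) ≡ j
  reaches-j = begin
    nimSumVec (updateAt gs i (λ x → x ∸ (g ∸ v)))  ≡⟨ nimSumVec-updateAt gs i (λ x → x ∸ (g ∸ v)) ⟩
    X ⊕ g ⊕ (g ∸ (g ∸ v))                          ≡⟨ cong (X ⊕ g ⊕_) (m∸[m∸n]≡n (<⇒≤ v<g)) ⟩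
    X ⊕ g ⊕ (g ⊕ d)                                ≡⟨ ⊕-assoc X g v ⟩
    X ⊕ (g ⊕ (g ⊕ d))                              ≡⟨ cong (X ⊕_) (x⊕[x⊕y]≡y g d) ⟩
    X ⊕ (j ⊕ X)                                    ≡⟨ ⊕-comm X d ⟩
    j ⊕ X ⊕ X                                      ≡⟨ x⊕y⊕y≡x j X ⟩
    j                                              ∎

grundy-star : ∀ {n} (p : Position (suc n)) → Acc (_<_ on potential) p →
              Grundy StarArc p (nimSumVec (tail p))
grundy-star {n} p (acc smaller) = mex _ options reachable
  where
  grundy-option : ∀ {q} → Move StarArc p q → Grundy StarArc q (nimSumVec (tail q))
  grundy-option {q} mv = grundy-star q (smaller (potential-decreasing mv))
  options : ∀ q → Move StarArc p q → Σ ℕ λ j → Grundy StarArc q j × j ≢ nimSumVec (tail p)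
  options q mv = _ , grundy-option mv , move-changes-nimSum mv
  reachable : ∀ j → j < nimSumVec (tail p) →
              Σ (Position (suc n)) λ q → Move StarArc p q × Grundy StarArc q j
  reachable j j<X with pull-to-nimSum p j<X
  ... | q , mv , refl = q , mv , grundy-option mv

theorem7 : (n g₀ : ℕ) (gs : Vec ℕ n) →
    Grundy (StarArc {n}) (g₀ ∷ gs) (nimSumVec gs)
theorem7 n g₀ gs = grundy-star (g₀ ∷ gs) (wellFounded potential <-wellFounded (g₀ ∷ gs))
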